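{- Let $L=\{l_n\}_{n\ge1}$ and $M=\{m_n\}_{n\ge1}$ be increasing sequences (finite or infinite) of positive even integers with $L\subseteq M$ (as sets of terms), with counting functions $L(y)=\#\{n:l_n\le y\}$, $M(y)=\#\{n:m_n\le y\}$. For a nonnegative even integer $x$, let $e(x)$ be the number of pairs $(a,b)$ with $a\le b$, $a+b=x$, such that ($a\in L$ and $b\in M$) or ($a\in M$ and $b\in L$). Then for every even $x\ge2$, $$e(x)=\sum_{m\in M,\ m\le x/2}L(x-m)+\sum_{l\in L,\ l\le x/2}\bigl(M(x-l)-L(x-l)\bigr)-L(x/2)\,M(x/2)+\binom{L(x/2)+1}{2}-e(x-2)-e(x-4)-\dots-e(0).$$ -}

module Defs where

open import Data.Bool using (Bool; true; false; T; _∧_; _∨_; if_then_else_)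
open import Data.Nat using (ℕ; zero; suc; _+_; _*_; _∸_; _≤ᵇ_)
open import Data.Nat.Divisibility using (_∣_)
open import Data.Integer using (ℤ; +_) renaming (_+_ to _+ℤ_)
open import Relation.Binary.PropositionalEquality using (_≢_)
open import Data.Product using (_×_)

-- A (finite or infinite) strictly increasing sequence of natural numbers
-- is identified with its set of terms, given as a decidable subset of ℕ.
NatSet : Set
NatSet = ℕ → Bool

_∈ˢ_ : ℕ → NatSet → Set
n ∈ˢ S = T (S n)

_⊆ˢ_ : NatSet → NatSet → Set
A ⊆ˢ B = ∀ n → n ∈ˢ A → n ∈ˢ B

PosEvenSet : NatSet → Set
PosEvenSet S = ∀ n → n ∈ˢ S → (n ≢ 0) × (2 ∣ n)

count : NatSet → ℕ → ℕ
count S zero    = if S zero then 1 else 0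
count S (suc y) = count S y + (if S (suc y) then 1 else 0)

sumOver : NatSet → (ℕ → ℤ) → ℕ → ℤ
sumOver S f zero    = if S zero then f zero else + 0
sumOver S f (suc y) = sumOver S f y +ℤ (if S (suc y) then f (suc y) else + 0)

sumBelow : (ℕ → ℤ) → ℕ → ℤ
sumBelow f zero    = + 0
sumBelow f (suc k) = sumBelow f k +ℤ f k

-- e(x) = #{ (a,b) : a ≤ b, a + b = x, (a ∈ L ∧ b ∈ M) ∨ (a ∈ M ∧ b ∈ L) }
-- (pairs are determined by a ∈ {0,…,x}, with b = x ∸ a)
e : NatSet → NatSet → ℕ → ℕ
e L M x = count (λ a → (a ≤ᵇ (x ∸ a)) ∧ ((L a ∧ M (x ∸ a)) ∨ (M a ∧ L (x ∸ a)))) x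

{-# OPTIONS --safe #-}
-- Write x = 2h and call (a, b) admissible when a ∈ L, b ∈ M or a ∈ M, b ∈ L. Count the
-- admissible pairs with a ≤ b and a + b ≤ x in two ways. Grouped by a + b they give
-- e(0) + e(2) + … + e(x), since every admissible pair consists of elements of M and so has an
-- even sum. Grouped by a ≤ h: as L ⊆ M, the admissible partners of a form M if a ∈ L, L if
-- a ∈ M ∖ L, and nothing otherwise; those with b ≤ x − a are counted by the two sums of the
-- formula, except that the pairs with b < a must be removed. By symmetry these number
-- L(h) M(h) − C(L(h) + 1, 2): ordered pairs of elements of M up to h with a coordinate in L
-- number 2 L(h) M(h) − L(h)², of which L(h) lie on the diagonal.
module Submission where

open import Defs
open import Data.Bool using (Bool; true; false; T; _∧_; _∨_; if_then_else_)
open import Data.Bool.Properties using (T-≡; ¬-not)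
open import Data.Empty using (⊥-elim)
open import Data.Nat using (ℕ; zero; suc; _∸_; _≤_; _<_; _≤ᵇ_; z≤n; s≤s; s≤s⁻¹; _/_)
open import Data.Nat.Divisibility using (_∣_; divides)
open import Data.Product using (_×_; _,_; proj₂)
open import Data.Sum using (inj₁; inj₂)
open import Function.Bundles using (Equivalence)
open import Relation.Binary.PropositionalEquality
open import Relation.Nullary using (¬_)

module Counting where
  open import Data.Nat using (_+_; _*_)
  open import Data.Nat.Properties
  open import Algebra.Properties.CommutativeSemigroup +-commutativeSemigroup using (xy∙z≈xz∙y)

  bit : Bool → ℕ
  bit b = if b then 1 else 0

  countBelow : NatSet → ℕ → ℕ
  countBelow S zero    = 0
  countBelow S (suc n) = count S n

  countBelow-suc : ∀ S n → countBelow S (suc n) ≡ countBelow S n + bit (S n)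
  countBelow-suc S zero    = refl
  countBelow-suc S (suc n) = refl

  count-cong : ∀ {S S′} n → (∀ a → a ≤ n → S a ≡ S′ a) → count S n ≡ count S′ n
  count-cong zero    S≗S′ = cong bit (S≗S′ 0 z≤n)
  count-cong (suc n) S≗S′ = cong₂ _+_ (count-cong n (λ a a≤n → S≗S′ a (m≤n⇒m≤1+n a≤n)))
                                      (cong bit (S≗S′ (suc n) ≤-refl))

  count-∅ : ∀ n → count (λ _ → false) n ≡ 0
  count-∅ zero    = refl
  count-∅ (suc n) = cong (_+ 0) (count-∅ n)

  countBelow-∅ : ∀ n → countBelow (λ _ → false) n ≡ 0
  countBelow-∅ zero    = refl
  countBelow-∅ (suc n) = count-∅ n

  count-beyond : ∀ S {n} m → n ≤ m → (∀ a → n < a → S a ≡ false) → count S m ≡ count S n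
  count-beyond S {n} m n≤m S>n≡false with m≤n⇒m<n∨m≡n n≤m
  ... | inj₂ refl = refl
  count-beyond S {n} (suc m) _ S>n≡false | inj₁ (s≤s n≤m) = begin
    count S m + bit (S (suc m)) ≡⟨ cong (λ b → count S m + bit b) (S>n≡false (suc m) (s≤s n≤m)) ⟩
    count S m + 0               ≡⟨ +-identityʳ _ ⟩
    count S m                   ≡⟨ count-beyond S m n≤m S>n≡false ⟩
    count S n                   ∎
    where open ≡-Reasoning

  ≤ᵇ-true : ∀ {m n} → m ≤ n → (m ≤ᵇ n) ≡ true
  ≤ᵇ-true m≤n = Equivalence.to T-≡ (≤⇒≤ᵇ m≤n)

  ≤ᵇ-false : ∀ {m n} → n < m → (m ≤ᵇ n) ≡ false
  ≤ᵇ-false {m} {n} n<m =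
    ¬-not (λ m≤ᵇn → <⇒≱ n<m (≤ᵇ⇒≤ m n (Equivalence.from T-≡ m≤ᵇn)))

  count-from+countBelow : ∀ S {a} c → a ≤ suc c →
                          count (λ b → (a ≤ᵇ b) ∧ S b) c + countBelow S a ≡ count S c
  count-from+countBelow S {zero}  zero    _ = +-identityʳ _
  count-from+countBelow S {suc zero} zero _ = refl
  count-from+countBelow S {suc (suc _)} zero (s≤s ())
  count-from+countBelow S {a} (suc c) a≤2+c with m≤n⇒m<n∨m≡n a≤2+c
  ... | inj₁ (s≤s a≤1+c) = begin
    count S≥a c + bit ((a ≤ᵇ suc c) ∧ S (suc c)) + countBelow S a
      ≡⟨ cong (λ b → count S≥a c + bit (b ∧ S (suc c)) + countBelow S a) (≤ᵇ-true a≤1+c) ⟩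
    count S≥a c + bit (S (suc c)) + countBelow S a
      ≡⟨ xy∙z≈xz∙y (count S≥a c) _ _ ⟩
    count S≥a c + countBelow S a + bit (S (suc c))
      ≡⟨ cong (_+ bit (S (suc c))) (count-from+countBelow S c a≤1+c) ⟩
    count S c + bit (S (suc c)) ∎
    where
    open ≡-Reasoning
    S≥a : NatSet
    S≥a b = (a ≤ᵇ b) ∧ S b
  ... | inj₂ refl = cong (_+ count S (suc c)) (trans (count-cong (suc c) S≥a≡∅) (count-∅ (suc c)))
    where
    S≥a≡∅ : ∀ b → b ≤ suc c → (suc (suc c) ≤ᵇ b) ∧ S b ≡ false
    S≥a≡∅ b b≤1+c = cong (_∧ S b) (≤ᵇ-false (s≤s b≤1+c))

  count-from-self : ∀ S a → count (λ b → (a ≤ᵇ b) ∧ S b) a ≡ bit (S a)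
  count-from-self S a = +-cancelˡ-≡ (countBelow S a) _ _ (begin
    countBelow S a + count (λ b → (a ≤ᵇ b) ∧ S b) a ≡⟨ +-comm (countBelow S a) _ ⟩
    count (λ b → (a ≤ᵇ b) ∧ S b) a + countBelow S a ≡⟨ count-from+countBelow S a (n≤1+n a) ⟩
    count S a                                      ≡⟨ countBelow-suc S a ⟩
    countBelow S a + bit (S a)                     ∎)
    where open ≡-Reasoning

module Arithmetic where
  open import Data.Nat using (_+_; _*_)
  open import Data.Nat.Properties
  open import Data.Nat.Combinatorics using (_C_; nC1≡n; nCk+nC[k+1]≡[n+1]C[k+1])
  open ≤-Reasoning

  n≤2*n : ∀ n → n ≤ 2 * n
  n≤2*n n = m≤m+n n (n + 0)

  2*n∸n≡n : ∀ n → 2 * n ∸ n ≡ n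
  2*n∸n≡n n = trans (cong (λ k → n + k ∸ n) (+-identityʳ n)) (m+n∸m≡n n n)

  m≤n⇒m≤2*n∸m : ∀ {m n} → m ≤ n → m ≤ 2 * n ∸ m
  m≤n⇒m≤2*n∸m {m} {n} m≤n = begin
    m         ≤⟨ m≤n ⟩
    n         ≡⟨ 2*n∸n≡n n ⟨
    2 * n ∸ n ≤⟨ ∸-monoʳ-≤ (2 * n) m≤n ⟩
    2 * n ∸ m ∎

  n<m⇒2*n∸m<m : ∀ {m n} → n < m → 2 * n ∸ m < m
  n<m⇒2*n∸m<m {m} {n} n<m = begin-strict
    2 * n ∸ m ≤⟨ ∸-monoʳ-≤ (2 * n) (<⇒≤ n<m) ⟩
    2 * n ∸ n ≡⟨ 2*n∸n≡n n ⟩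
    n         <⟨ n<m ⟩
    m         ∎

  2*[1+n]∸m≡2+[2*n∸m] : ∀ {m n} → m ≤ 2 * n → 2 * suc n ∸ m ≡ 2 + (2 * n ∸ m)
  2*[1+n]∸m≡2+[2*n∸m] {m} {n} m≤2n = trans (cong (_∸ m) (*-suc 2 n)) (+-∸-assoc 2 m≤2n)

  [n+1]C2≡nC2+n : ∀ n → (n + 1) C 2 ≡ n C 2 + n
  [n+1]C2≡nC2+n n = begin-equality
    (n + 1) C 2      ≡⟨ cong (_C 2) (+-comm n 1) ⟩
    suc n C 2        ≡⟨ nCk+nC[k+1]≡[n+1]C[k+1] n 1 ⟨
    n C 1 + n C 2    ≡⟨ cong (_+ n C 2) (nC1≡n n) ⟩
    n + n C 2        ≡⟨ +-comm n (n C 2) ⟩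
    n C 2 + n        ∎

module AdmissiblePairs (L M : NatSet) (L⊆M : L ⊆ˢ M) (M-even : ∀ n → n ∈ˢ M → 2 ∣ n) where
  open import Data.Nat using (_+_; _*_)
  open import Data.Nat.Properties
  open import Data.Nat.Divisibility using (∣m∣n⇒∣m+n)
  open import Data.Bool.Properties using (∧-zeroʳ; T-∨; T-∧)
  open Counting
  open Arithmetic

  admissible : ℕ → ℕ → Bool
  admissible a b = (L a ∧ M b) ∨ (M a ∧ L b)

  partner : ℕ → NatSet
  partner a = if L a then M else if M a then L else λ _ → false

  admissible≡partner : ∀ a b → admissible a b ≡ partner a b
  admissible≡partner a b with L a | M a | L⊆M a
  ... | true  | true  | _     = ∨-absorbs-implied (M b) (L b) (L⊆M b)
    where
    ∨-absorbs-implied : ∀ x y → (T y → T x) → x ∨ y ≡ x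
    ∨-absorbs-implied true  _     _   = refl
    ∨-absorbs-implied false false _   = refl
    ∨-absorbs-implied false true  y⇒x = ⊥-elim (y⇒x _)
  ... | true  | false | La⇒Ma = ⊥-elim (La⇒Ma _)
  ... | false | true  | _     = refl
  ... | false | false | _     = refl

  admissible⇒∈M : ∀ a b → T (admissible a b) → a ∈ˢ M × b ∈ˢ M
  admissible⇒∈M a b adm with Equivalence.to T-∨ adm
  ... | inj₁ La∧Mb = let (La , Mb) = Equivalence.to T-∧ La∧Mb in L⊆M a La , Mb
  ... | inj₂ Ma∧Lb = let (Ma , Lb) = Equivalence.to T-∧ Ma∧Lb in Ma , L⊆M b Lb

  admissible-odd : ∀ a b n → a + b ≡ suc (2 * n) → admissible a b ≡ false
  admissible-odd a b n a+b≡odd = ¬-not λ adm → 2∤odd (subst (2 ∣_) a+b≡odd (even-sum adm))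
    where
    even-sum : admissible a b ≡ true → 2 ∣ a + b
    even-sum adm = let (a∈M , b∈M) = admissible⇒∈M a b (Equivalence.from T-≡ adm)
                   in ∣m∣n⇒∣m+n (M-even a a∈M) (M-even b b∈M)
    2∤odd : ¬ 2 ∣ suc (2 * n)
    2∤odd (divides q eq) = even≢odd q n (trans (*-comm 2 q) (sym eq))

  pairsFrom : ℕ → ℕ → ℕ
  pairsFrom a c = count (λ b → (a ≤ᵇ b) ∧ admissible a b) c

  pairsFrom+countBelow : ∀ a c → a ≤ suc c →
                         pairsFrom a c + countBelow (partner a) a ≡ count (partner a) c
  pairsFrom+countBelow a c a≤1+c = trans (cong (_+ countBelow (partner a) a) pairsFrom≡)
                                         (count-from+countBelow (partner a) c a≤1+c)
    where
    pairsFrom≡ : pairsFrom a c ≡ count (λ b → (a ≤ᵇ b) ∧ partner a b) c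
    pairsFrom≡ = count-cong c λ b _ → cong ((a ≤ᵇ b) ∧_) (admissible≡partner a b)

  pairsFrom-diag : ∀ a → pairsFrom a a ≡ bit (admissible a a)
  pairsFrom-diag a = count-from-self (admissible a) a

  pairsFrom-step : ∀ {h a} → a ≤ h →
    pairsFrom a (2 * suc h ∸ a) ≡ pairsFrom a (2 * h ∸ a) + bit (admissible a (2 * suc h ∸ a))
  pairsFrom-step {h} {a} a≤h = begin
    pairsFrom a (2 * suc h ∸ a)
      ≡⟨ cong (pairsFrom a) 2[1+h]∸a≡2+c ⟩
    pairsFrom a c + bit ((a ≤ᵇ suc c) ∧ admissible a (suc c))
                  + bit ((a ≤ᵇ 2 + c) ∧ admissible a (2 + c))
      ≡⟨ cong₂ (λ x y → pairsFrom a c + bit x + bit (y ∧ admissible a (2 + c)))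
               odd-sum-excluded (≤ᵇ-true a≤2+c) ⟩
    pairsFrom a c + 0 + bit (admissible a (2 + c))
      ≡⟨ cong (_+ bit (admissible a (2 + c))) (+-identityʳ _) ⟩
    pairsFrom a c + bit (admissible a (2 + c))
      ≡⟨ cong (λ b → pairsFrom a c + bit (admissible a b)) 2[1+h]∸a≡2+c ⟨
    pairsFrom a c + bit (admissible a (2 * suc h ∸ a)) ∎
    where
    open ≡-Reasoning
    c : ℕ
    c = 2 * h ∸ a
    a≤2h : a ≤ 2 * h
    a≤2h = ≤-trans a≤h (n≤2*n h)
    2[1+h]∸a≡2+c : 2 * suc h ∸ a ≡ 2 + c
    2[1+h]∸a≡2+c = 2*[1+n]∸m≡2+[2*n∸m] a≤2h
    a≤2+c : a ≤ 2 + c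
    a≤2+c = ≤-trans (m≤n⇒m≤2*n∸m a≤h) (m≤n+m c 2)
    odd-sum-excluded : (a ≤ᵇ suc c) ∧ admissible a (suc c) ≡ false
    odd-sum-excluded =
      trans (cong ((a ≤ᵇ suc c) ∧_) (admissible-odd a (suc c) h a+1+c≡1+2h)) (∧-zeroʳ _)
      where
      a+1+c≡1+2h : a + suc c ≡ suc (2 * h)
      a+1+c≡1+2h = trans (+-suc a c) (cong suc (m+[n∸m]≡n a≤2h))

  e-as-count : ∀ n → e L M (2 * n) ≡ count (λ a → admissible a (2 * n ∸ a)) n
  e-as-count n = trans (count-beyond _ (2 * n) (n≤2*n n) excluded) (count-cong n included)
    where
    excluded : ∀ a → n < a → (a ≤ᵇ 2 * n ∸ a) ∧ admissible a (2 * n ∸ a) ≡ false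
    excluded a n<a = cong (_∧ admissible a (2 * n ∸ a)) (≤ᵇ-false (n<m⇒2*n∸m<m n<a))
    included : ∀ a → a ≤ n →
               (a ≤ᵇ 2 * n ∸ a) ∧ admissible a (2 * n ∸ a) ≡ admissible a (2 * n ∸ a)
    included a a≤n = cong (_∧ admissible a (2 * n ∸ a)) (≤ᵇ-true (m≤n⇒m≤2*n∸m a≤n))

import Data.Nat as ℕ
open Counting using (bit; countBelow; countBelow-suc; count-∅; countBelow-∅)
open import Data.Nat.Properties using (≤-refl; m<n⇒m<1+n; m≤n⇒m≤1+n)
import Data.Nat.Properties as NP
open import Data.Nat.DivMod using (m*n/n≡m)
open import Data.Nat.Combinatorics using (_C_)
open import Data.Integer using (ℤ; +_; _+_; _-_; _*_)
import Data.Integer.Properties as ℤ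
open import Data.Integer.Tactic.RingSolver using (solve-∀)
open import Algebra.Properties.CommutativeSemigroup ℤ.+-commutativeSemigroup using (interchange)

sumBelow-cong : ∀ {f g} n → (∀ a → a < n → f a ≡ g a) → sumBelow f n ≡ sumBelow g n
sumBelow-cong zero    _   = refl
sumBelow-cong (suc n) f≗g =
  cong₂ _+_ (sumBelow-cong n λ a a<n → f≗g a (m<n⇒m<1+n a<n)) (f≗g n ≤-refl)

sumBelow-distrib-+ : ∀ f g n → sumBelow (λ a → f a + g a) n ≡ sumBelow f n + sumBelow g n
sumBelow-distrib-+ f g zero    = refl
sumBelow-distrib-+ f g (suc n) =
  trans (cong (_+ (f n + g n)) (sumBelow-distrib-+ f g n))
        (interchange (sumBelow f n) (sumBelow g n) (f n) (g n))

sumOver≡sumBelow : ∀ S f n → sumOver S f n ≡ sumBelow (λ a → if S a then f a else + 0) (suc n)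
sumOver≡sumBelow S f zero    = sym (ℤ.+-identityˡ _)
sumOver≡sumBelow S f (suc n) = cong (_+ (if S (suc n) then f (suc n) else + 0)) (sumOver≡sumBelow S f n)

+count≡sumBelow : ∀ S n → + count S n ≡ sumBelow (λ a → + bit (S a)) (suc n)
+count≡sumBelow S zero    = sym (ℤ.+-identityˡ _)
+count≡sumBelow S (suc n) =
  trans (ℤ.pos-+ (count S n) _) (cong (_+ + bit (S (suc n))) (+count≡sumBelow S n))

lowerPairs-step : ∀ (lb mb : Bool) → (T lb → T mb) → ∀ l m →
  (+ l * + m - + ((l ℕ.+ 1) C 2)) + ((if mb then + l else + 0) + (if lb then + m - + l else + 0))
    ≡ + (l ℕ.+ bit lb) * + (m ℕ.+ bit mb) - + ((l ℕ.+ bit lb ℕ.+ 1) C 2)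
lowerPairs-step true true _ l m
  rewrite Arithmetic.[n+1]C2≡nC2+n (l ℕ.+ 1) | ℤ.pos-+ ((l ℕ.+ 1) C 2) (l ℕ.+ 1)
        | ℤ.pos-+ l 1 | ℤ.pos-+ m 1 = add-to-both (+ l) (+ m) (+ ((l ℕ.+ 1) C 2))
  where
  add-to-both : ∀ l m c → (l * m - c) + (l + (m - l)) ≡ (l + + 1) * (m + + 1) - (c + (l + + 1))
  add-to-both = solve-∀
lowerPairs-step true false lb⇒mb _ _ = ⊥-elim (lb⇒mb _)
lowerPairs-step false true _ l m
  rewrite ℤ.pos-+ m 1 | NP.+-identityʳ l = add-to-M (+ l) (+ m) (+ ((l ℕ.+ 1) C 2))
  where
  add-to-M : ∀ l m c → (l * m - c) + l ≡ l * (m + + 1) - c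
  add-to-M = solve-∀
lowerPairs-step false false _ l m
  rewrite NP.+-identityʳ l | NP.+-identityʳ m = ℤ.+-identityʳ _

module DoubleCounting (L M : NatSet) (L⊆M : L ⊆ˢ M) (M-even : ∀ n → n ∈ˢ M → 2 ∣ n) where
  open AdmissiblePairs L M L⊆M M-even
  open Arithmetic using (m≤n⇒m≤2*n∸m; 2*n∸n≡n)
  open ≡-Reasoning

  partner-by-indicators : (F : NatSet → ℤ) → F (λ _ → false) ≡ + 0 → ∀ a →
    (if M a then F L else + 0) + (if L a then F M - F L else + 0) ≡ F (partner a)
  partner-by-indicators F F∅≡0 a with L a | M a | L⊆M a
  ... | true  | true  | _     = x+[y-x]≡y (F L) (F M)
    where
    x+[y-x]≡y : ∀ x y → x + (y - x) ≡ y
    x+[y-x]≡y = solve-∀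
  ... | true  | false | La⇒Ma = ⊥-elim (La⇒Ma _)
  ... | false | true  | _     = ℤ.+-identityʳ (F L)
  ... | false | false | _     = sym F∅≡0

  lowerPairs : ℕ → ℤ
  lowerPairs n = sumBelow (λ a → + countBelow (partner a) a) n

  lowerPairs-closed-form : ∀ n →
    lowerPairs n ≡ + countBelow L n * + countBelow M n - + ((countBelow L n ℕ.+ 1) C 2)
  lowerPairs-closed-form zero    = refl
  lowerPairs-closed-form (suc n) = begin
    lowerPairs n + + countBelow (partner n) n
      ≡⟨ cong₂ _+_ (lowerPairs-closed-form n)
                   (sym (partner-by-indicators (λ S → + countBelow S n) (cong +_ (countBelow-∅ n)) n)) ⟩
    (+ l * + m - + ((l ℕ.+ 1) C 2)) + ((if M n then + l else + 0) + (if L n then + m - + l else + 0))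
      ≡⟨ lowerPairs-step (L n) (M n) (L⊆M n) l m ⟩
    + (l ℕ.+ bit (L n)) * + (m ℕ.+ bit (M n)) - + ((l ℕ.+ bit (L n) ℕ.+ 1) C 2)
      ≡⟨ cong₂ (λ l′ m′ → + l′ * + m′ - + ((l′ ℕ.+ 1) C 2))
               (countBelow-suc L n) (countBelow-suc M n) ⟨
    + countBelow L (suc n) * + countBelow M (suc n) - + ((countBelow L (suc n) ℕ.+ 1) C 2) ∎
    where
    l m : ℕ
    l = countBelow L n
    m = countBelow M n

  triangle : ℕ → ℤ
  triangle h = sumBelow (λ a → + pairsFrom a (2 ℕ.* h ∸ a)) (suc h)

  triangle≡sum-e : ∀ h → triangle h ≡ sumBelow (λ j → + e L M (2 ℕ.* j)) (suc h)
  triangle≡sum-e zero    = refl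
  triangle≡sum-e (suc h) = begin
    sumBelow (λ a → + pairsFrom a (2 ℕ.* suc h ∸ a)) (suc h) + + pairsFrom (suc h) (2 ℕ.* suc h ∸ suc h)
      ≡⟨ cong₂ _+_ (sumBelow-cong (suc h) λ a a<1+h → step (s≤s⁻¹ a<1+h)) (cong +_ middle) ⟩
    sumBelow (λ a → old a + new a) (suc h) + new (suc h)
      ≡⟨ cong (_+ new (suc h)) (sumBelow-distrib-+ old new (suc h)) ⟩
    triangle h + sumBelow new (suc h) + new (suc h)
      ≡⟨ ℤ.+-assoc (triangle h) _ _ ⟩
    triangle h + sumBelow new (suc (suc h))
      ≡⟨ cong₂ _+_ (triangle≡sum-e h) (sym (+count≡sumBelow sum2h+2 (suc h))) ⟩
    sumBelow (λ j → + e L M (2 ℕ.* j)) (suc h) + + count sum2h+2 (suc h)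
      ≡⟨ cong (λ k → sumBelow (λ j → + e L M (2 ℕ.* j)) (suc h) + + k) (e-as-count (suc h)) ⟨
    sumBelow (λ j → + e L M (2 ℕ.* j)) (suc (suc h)) ∎
    where
    sum2h+2 : NatSet
    sum2h+2 a = admissible a (2 ℕ.* suc h ∸ a)
    old new : ℕ → ℤ
    old a = + pairsFrom a (2 ℕ.* h ∸ a)
    new a = + bit (sum2h+2 a)
    step : ∀ {a} → a ≤ h → + pairsFrom a (2 ℕ.* suc h ∸ a) ≡ old a + new a
    step {a} a≤h = trans (cong +_ (pairsFrom-step a≤h)) (ℤ.pos-+ (pairsFrom a (2 ℕ.* h ∸ a)) _)
    middle : pairsFrom (suc h) (2 ℕ.* suc h ∸ suc h) ≡ bit (sum2h+2 (suc h))
    middle = subst (λ c → pairsFrom (suc h) c ≡ bit (admissible (suc h) c))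
                   (sym (2*n∸n≡n (suc h))) (pairsFrom-diag (suc h))

  sumOver-counts≡triangle+lowerPairs : ∀ h →
    sumOver M (λ m → + count L (2 ℕ.* h ∸ m)) h
    + sumOver L (λ l → + count M (2 ℕ.* h ∸ l) - + count L (2 ℕ.* h ∸ l)) h
    ≡ triangle h + lowerPairs (suc h)
  sumOver-counts≡triangle+lowerPairs h = begin
    sumOver M (λ m → F L m) h + sumOver L (λ l → F M l - F L l) h
      ≡⟨ cong₂ _+_ (sumOver≡sumBelow M (F L) h) (sumOver≡sumBelow L (λ l → F M l - F L l) h) ⟩
    sumBelow inM (suc h) + sumBelow inL (suc h)
      ≡⟨ sumBelow-distrib-+ inM inL (suc h) ⟨
    sumBelow (λ a → inM a + inL a) (suc h)
      ≡⟨ sumBelow-cong (suc h) (λ a a<1+h → trans (by-partner a) (split (s≤s⁻¹ a<1+h))) ⟩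
    sumBelow (λ a → pairs a + below a) (suc h)
      ≡⟨ sumBelow-distrib-+ pairs below (suc h) ⟩
    triangle h + lowerPairs (suc h) ∎
    where
    F : NatSet → ℕ → ℤ
    F S a = + count S (2 ℕ.* h ∸ a)
    inM inL : ℕ → ℤ
    inM a = if M a then F L a else + 0
    inL a = if L a then F M a - F L a else + 0
    pairs below : ℕ → ℤ
    pairs a = + pairsFrom a (2 ℕ.* h ∸ a)
    below a = + countBelow (partner a) a
    by-partner : ∀ a → inM a + inL a ≡ F (partner a) a
    by-partner a = partner-by-indicators (λ S → F S a) (cong +_ (count-∅ (2 ℕ.* h ∸ a))) a
    split : ∀ {a} → a ≤ h → F (partner a) a ≡ pairs a + below a
    split {a} a≤h = trans (cong +_ (sym (pairsFrom+countBelow a (2 ℕ.* h ∸ a) a≤1+[2h∸a])))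
                          (ℤ.pos-+ (pairsFrom a (2 ℕ.* h ∸ a)) _)
      where
      a≤1+[2h∸a] : a ≤ suc (2 ℕ.* h ∸ a)
      a≤1+[2h∸a] = m≤n⇒m≤1+n (m≤n⇒m≤2*n∸m a≤h)

  e-formula : ∀ h → + e L M (2 ℕ.* h) ≡
    sumOver M (λ m → + count L (2 ℕ.* h ∸ m)) h
    + sumOver L (λ l → + count M (2 ℕ.* h ∸ l) - + count L (2 ℕ.* h ∸ l)) h
    - + count L h * + count M h
    + + ((count L h ℕ.+ 1) C 2)
    - sumBelow (λ j → + e L M (2 ℕ.* j)) h
  e-formula h = begin
    + e L M (2 ℕ.* h)
      ≡⟨ y≡[x+y]-x earlier (+ e L M (2 ℕ.* h)) ⟩
    sumBelow (λ j → + e L M (2 ℕ.* j)) (suc h) - earlier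
      ≡⟨ cong (_- earlier) (triangle≡sum-e h) ⟨
    triangle h - earlier
      ≡⟨ cong (_- earlier) (x≡[x+y]-y (triangle h) lower) ⟩
    triangle h + lower - lower - earlier
      ≡⟨ cong (λ s → s - lower - earlier) (sumOver-counts≡triangle+lowerPairs h) ⟨
    A + B - lower - earlier
      ≡⟨ cong (λ z → A + B - z - earlier) (lowerPairs-closed-form (suc h)) ⟩
    A + B - (+ count L h * + count M h - + ((count L h ℕ.+ 1) C 2)) - earlier
      ≡⟨ regroup A B (+ count L h * + count M h) (+ ((count L h ℕ.+ 1) C 2)) earlier ⟩
    A + B - + count L h * + count M h + + ((count L h ℕ.+ 1) C 2) - earlier ∎
    where
    A B earlier lower : ℤ
    A = sumOver M (λ m → + count L (2 ℕ.* h ∸ m)) h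
    B = sumOver L (λ l → + count M (2 ℕ.* h ∸ l) - + count L (2 ℕ.* h ∸ l)) h
    earlier = sumBelow (λ j → + e L M (2 ℕ.* j)) h
    lower = lowerPairs (suc h)
    y≡[x+y]-x : ∀ x y → y ≡ x + y - x
    y≡[x+y]-x = solve-∀
    x≡[x+y]-y : ∀ x y → x ≡ x + y - y
    x≡[x+y]-y = solve-∀
    regroup : ∀ a b p c s → a + b - (p - c) - s ≡ a + b - p + c - s
    regroup = solve-∀

corollary3 : (L M : NatSet) → PosEvenSet L → PosEvenSet M → L ⊆ˢ M →
    (x : ℕ) → 2 ∣ x → 2 ≤ x →
    + (e L M x) ≡
      sumOver M (λ m → + count L (x ∸ m)) (x / 2)
      + sumOver L (λ l → + count M (x ∸ l) - + count L (x ∸ l)) (x / 2)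
      - + count L (x / 2) * + count M (x / 2)
      + + ((count L (x / 2) Data.Nat.+ 1) C 2)
      - sumBelow (λ j → + e L M (2 Data.Nat.* j)) (x / 2)
corollary3 L M _ M⁺ L⊆M _ (divides h refl) _ rewrite m*n/n≡m h 2 ⦃ _ ⦄ | NP.*-comm h 2 =
  DoubleCounting.e-formula L M L⊆M (λ n n∈M → proj₂ (M⁺ n n∈M)) h
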